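{- Let $M_1$ and $M_2$ be matroids with $E(M_1)\cap E(M_2)=\emptyset$. Let $X_1\subseteq E(M_1)$ and $X_2\subseteq E(M_2)$, let $m_1$ be the number of minors of $M_1$ on $E(M_1)\setminus X_1$, and let $m_2$ be the number of minors of $M_2$ on $E(M_2)\setminus X_2$. Then the number of minors of $M_1\oplus M_2$ on $(E(M_1)\cup E(M_2))\setminus(X_1\cup X_2)$ is $m_1m_2$.
   Context: $E(M)$ is the ground set of $M$. The direct sum $M_1\oplus M_2$ has ground set $E(M_1)\cup E(M_2)$ and independent sets $I_1\cup I_2$ with $I_j$ independent in $M_j$. For a matroid $N$ and disjoint $X,Y\subseteq E(N)$, $N\setminus X/Y$ is the matroid obtained by deleting $X$ and contracting $Y$. For $X\subseteq E(N)$, the minors of $N$ on $E(N)\setminus X$ are the matroids $N\setminus(X\setminus Y)/Y$ for $Y\subseteq X$; their number is the number of distinct such matroids (distinct collections of independent sets). -}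

module Defs where

open import Data.Nat using (ℕ; zero; suc; _+_; _<_)
open import Data.Bool using (Bool; true; false; T; not; _∧_; _∨_)
open import Data.Bool.Properties using () renaming (_≟_ to _≟ᵇ_)
open import Data.Fin using (Fin)
open import Data.Fin.Subset using (Subset; inside; outside; _∈_; _∉_; _⊆_; ⁅_⁆; ∣_∣)
  renaming (⊥ to ∅; _∪_ to _∪ₛ_; _∩_ to _∩ₛ_; _─_ to _∖_)
open import Data.Vec as Vec using (Vec; []; _∷_)
open import Data.List as List using (List; [_]; _++_; filter; deduplicate; length)
open import Data.Bool.ListAction using (any)
import Data.Vec.Properties as VecP
import Data.List.Properties as ListP
open import Data.Product using (∃-syntax; _×_)
open import Relation.Binary.PropositionalEquality using (_≡_)
open import Relation.Binary.Definitions using (DecidableEquality)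

allSubsets : ∀ n → List (Subset n)
allSubsets zero = [ [] ]
allSubsets (suc n) = List.map (inside ∷_) (allSubsets n) ++ List.map (outside ∷_) (allSubsets n)

subsetᵇ : ∀ {n} → Subset n → Subset n → Bool
subsetᵇ [] [] = true
subsetᵇ (x ∷ xs) (y ∷ ys) = (not x ∨ y) ∧ subsetᵇ xs ys

eqSubᵇ : ∀ {n} → Subset n → Subset n → Bool
eqSubᵇ A B = subsetᵇ A B ∧ subsetᵇ B A

disjointᵇ : ∀ {n} → Subset n → Subset n → Bool
disjointᵇ A B = eqSubᵇ (A ∩ₛ B) ∅

record Matroid (n : ℕ) : Set where
  field
    indep : Subset n → Bool
    indep-∅ : T (indep ∅)
    indep-⊆ : ∀ I J → I ⊆ J → T (indep J) → T (indep I)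
    indep-aug : ∀ I J → T (indep I) → T (indep J) → ∣ I ∣ < ∣ J ∣ →
                ∃[ x ] (x ∈ J × x ∉ I × T (indep (⁅ x ⁆ ∪ₛ I)))

open Matroid public

Oracle : ℕ → Set
Oracle n = Subset n → Bool

isBasisOfᵇ : ∀ {n} → Oracle n → Subset n → Subset n → Bool
isBasisOfᵇ {n} ind C J =
  subsetᵇ J C ∧ ind J ∧
  not (any (λ K → subsetᵇ J K ∧ subsetᵇ K C ∧ not (eqSubᵇ J K) ∧ ind K) (allSubsets n))

-- Independent sets of N \ D / C  (D, C disjoint):  I is independent iff
-- I avoids D ∪ C and I ∪ B_C is independent in N for a basis B_C of C.
minorIndep : ∀ {n} → Oracle n → (D C : Subset n) → Oracle n
minorIndep {n} ind D C I =
  disjointᵇ I (D ∪ₛ C) ∧ any (λ J → isBasisOfᵇ ind C J ∧ ind (I ∪ₛ J)) (allSubsets n)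

indepSets : ∀ {n} → Oracle n → List (Subset n)
indepSets {n} ind = filter (λ I → T? (ind I)) (allSubsets n)
  where open import Relation.Nullary.Decidable using () renaming (T? to T?)

_≟ₛ_ : ∀ {n} → DecidableEquality (Subset n)
_≟ₛ_ = VecP.≡-dec _≟ᵇ_

_≟ₗ_ : ∀ {n} → DecidableEquality (List (Subset n))
_≟ₗ_ = ListP.≡-dec _≟ₛ_

-- The minors of N on E(N) \ X :  N \ (X \ Y) / Y  for Y ⊆ X,
-- each given by its collection of independent sets.
minorsOn : ∀ {n} → Oracle n → Subset n → List (List (Subset n))
minorsOn {n} ind X =
  List.map (λ Y → indepSets (minorIndep ind (X ∖ Y) Y))
           (filter (λ Y → T? (subsetᵇ Y X)) (allSubsets n))
  where open import Relation.Nullary.Decidable using () renaming (T? to T?)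

numMinorsOn : ∀ {n} → Oracle n → Subset n → ℕ
numMinorsOn ind X = length (deduplicate _≟ₗ_ (minorsOn ind X))

-- Direct sum M₁ ⊕ M₂ on the disjoint union Fin (a + b) of the ground sets
-- (first a elements from E(M₁), last b from E(M₂)):  I₁ ∪ I₂ independent
-- iff I₁ independent in M₁ and I₂ independent in M₂.
directSum : ∀ {a b} → Matroid a → Matroid b → Oracle (a + b)
directSum {a} M₁ M₂ I = indep M₁ (Vec.take a I) ∧ indep M₂ (Vec.drop a I)

-- Subsets of the disjoint union Fin (a + b) are the concatenations u ++ v, and a set is
-- independent in M₁ ⊕ M₂ iff both halves are.  A proper independent extension of J₁ ++ J₂
-- inside C₁ ++ C₂ properly extends one of the halves, so the bases of C₁ ++ C₂ are exactly
-- the concatenations of bases of C₁ and of C₂.  Hence for Y = Y₁ ++ Y₂ the minor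
-- (M₁ ⊕ M₂) \ (X ∖ Y) / Y is the direct sum of the corresponding minors of M₁ and M₂, and
-- the list of minors of M₁ ⊕ M₂ is the cartesian product of the two lists of minors.
-- Since bases exist, ∅ is independent in every minor, so both factors can be read back off
-- a product family; distinct pairs therefore give distinct minors and the counts multiply.
module Submission where

open import Defs
open import Data.Nat using (ℕ; _+_; _*_)
open import Data.Fin.Subset using (Subset)
open import Data.Vec using (_++_)
open import Relation.Binary.PropositionalEquality using (_≡_)

open import Algebra.Bundles using (CommutativeMonoid)
open import Data.Bool using (Bool; true; false; T; not; _∧_; _∨_)
open import Data.Bool.ListAction using (any)
open import Data.Bool.Properties using (T-∧; ∧-assoc; ∧-commutativeMonoid)
open import Data.Empty using (⊥-elim)
open import Data.Fin.Subset using (inside; outside; ∣_∣)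
  renaming (⊥ to ∅; _∪_ to _∪ₛ_; _∩_ to _∩ₛ_; _─_ to _∖_)
open import Data.Fin.Subset.Properties using (∪-identityˡ)
open import Data.List using (List; []; _∷_; map; filterᵇ; length; deduplicate; cartesianProductWith; cartesianProduct)
  renaming (_++_ to _++ₗ_)
open import Data.List.Extrema.Nat using (argmax; argmax-all; f[xs]≤f[argmax])
open import Data.List.Membership.Propositional using (_∈_; lose)
open import Data.List.Membership.Propositional.Properties
  using ( ∈-++⁺ˡ; ∈-++⁺ʳ; ∈-map⁺; ∈-map⁻; ∈-filter⁺; ∈-filter⁻; ∈-deduplicate⁺; ∈-deduplicate⁻
        ; ∈-cartesianProductWith⁺; ∈-cartesianProductWith⁻; ∈-cartesianProduct⁻)
open import Data.List.Membership.Propositional.Properties.WithK using (unique∧set⇒bag)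
open import Data.List.Properties
  using ( length-++; length-map; map-++; map-∘; map-cong; map-id; ++-identityʳ
        ; filter-++; filter-none; filter-≐; cartesianProductWith-distribʳ-++)
open import Data.List.Relation.Binary.BagAndSetEquality using (∼bag⇒↭)
open import Data.List.Relation.Binary.Permutation.Propositional.Properties using (↭-length)
open import Data.List.Relation.Binary.Subset.Propositional using (_⊆_)
open import Data.List.Relation.Binary.Subset.Propositional.Properties using (⊆-reflexive)
import Data.List.Relation.Unary.All as All
import Data.List.Relation.Unary.All.Properties as All
open import Data.List.Relation.Unary.AllPairs using ([]; _∷_)
open import Data.List.Relation.Unary.Any using (here; there; satisfied)
import Data.List.Relation.Unary.Any.Properties as Any
open import Data.List.Relation.Unary.Unique.Propositional using (Unique)
import Data.List.Relation.Unary.Unique.Propositional.Properties as Unique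
open import Data.List.Relation.Unary.Unique.DecPropositional.Properties using (deduplicate-!)
open import Data.Nat using (zero; suc; _≤_; _<_; z≤n; s≤s)
open import Data.Nat.Properties using (m≤n⇒m≤1+n; <⇒≱)
open import Data.Product using (∃-syntax; _×_; _,_; proj₁; proj₂; uncurry)
import Data.Product as Product
open import Data.Product.Properties using (×-≡,≡→≡)
open import Data.Sum using (_⊎_; inj₁; inj₂; [_,_]′)
open import Data.Vec using (Vec; []; _∷_; take; drop; splitAt)
open import Data.Vec.Properties using (zipWith-++; ++-injectiveˡ; ++-injectiveʳ)
open import Function using (_∘_; const; _⇔_; mk⇔; Equivalence)
open import Relation.Binary.Definitions using (DecidableEquality)
open import Relation.Binary.PropositionalEquality
  using (_≢_; refl; sym; trans; cong; cong₂; subst; module ≡-Reasoning)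
open import Relation.Nullary.Decidable using (T?; yes; no)
open import Relation.Nullary.Negation using (¬_)

open Equivalence using (to; from)
open import Algebra.Properties.CommutativeSemigroup (CommutativeMonoid.commutativeSemigroup ∧-commutativeMonoid)
  using () renaming (interchange to ∧-interchange)

T-injective : ∀ {x y} → (T x ⇔ T y) → x ≡ y
T-injective {false} {false} _   = refl
T-injective {false} {true}  x⇔y = ⊥-elim (x⇔y .from _)
T-injective {true}  {false} x⇔y = ⊥-elim (x⇔y .to _)
T-injective {true}  {true}  _   = refl

T-not : ∀ {x} → T (not x) ⇔ (¬ T x)
T-not {false} = mk⇔ (λ _ ()) (λ _ → _)
T-not {true}  = mk⇔ (λ ()) (λ ¬t → ¬t _)

T-split : ∀ {b x y} → b ≡ x ∧ y → T b ⇔ (T x × T y)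
T-split refl = T-∧

-- Cartesian products of lists

module _ {A B C : Set} (f : A → B → C) where

  length-cartesianProductWith : ∀ xs ys → length (cartesianProductWith f xs ys) ≡ length xs * length ys
  length-cartesianProductWith []       ys = refl
  length-cartesianProductWith (x ∷ xs) ys = trans (length-++ (map (f x) ys))
    (cong₂ _+_ (length-map (f x) ys) (length-cartesianProductWith xs ys))

  map-cartesianProductWith : ∀ {D : Set} (h : C → D) xs ys →
    map h (cartesianProductWith f xs ys) ≡ cartesianProductWith (λ x y → h (f x y)) xs ys
  map-cartesianProductWith h []       ys = refl
  map-cartesianProductWith h (x ∷ xs) ys = trans (map-++ h (map (f x) ys) _)
    (cong₂ _++ₗ_ (sym (map-∘ ys)) (map-cartesianProductWith h xs ys))

  cartesianProductWith-mapˡ : ∀ {A′ : Set} (g : A′ → A) xs ys →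
    cartesianProductWith f (map g xs) ys ≡ cartesianProductWith (λ x y → f (g x) y) xs ys
  cartesianProductWith-mapˡ g []       ys = refl
  cartesianProductWith-mapˡ g (x ∷ xs) ys = cong (map (f (g x)) ys ++ₗ_) (cartesianProductWith-mapˡ g xs ys)

  cartesianProductWith-mapʳ : ∀ {B′ : Set} (h : B′ → B) xs ys →
    cartesianProductWith f xs (map h ys) ≡ cartesianProductWith (λ x y → f x (h y)) xs ys
  cartesianProductWith-mapʳ h []       ys = refl
  cartesianProductWith-mapʳ h (x ∷ xs) ys = cong₂ _++ₗ_ (sym (map-∘ ys)) (cartesianProductWith-mapʳ h xs ys)

  cartesianProductWith-mono : ∀ {xs xs′ ys ys′} → xs ⊆ xs′ → ys ⊆ ys′ →
    cartesianProductWith f xs ys ⊆ cartesianProductWith f xs′ ys′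
  cartesianProductWith-mono {xs} {ys = ys} xs⊆xs′ ys⊆ys′ z∈ with ∈-cartesianProductWith⁻ f xs ys z∈
  ... | x , y , x∈xs , y∈ys , refl = ∈-cartesianProductWith⁺ f (xs⊆xs′ x∈xs) (ys⊆ys′ y∈ys)

module _ {A B C : Set} {f : A → B → C} {xs xs′ : List A} {ys ys′ : List B}
         (prod⊆ : cartesianProductWith f xs ys ⊆ cartesianProductWith f xs′ ys′) where

  cartesianProductWith-cancelˡ : (∀ {x x′ y y′} → f x y ≡ f x′ y′ → x ≡ x′) → ∀ {y} → y ∈ ys → xs ⊆ xs′
  cartesianProductWith-cancelˡ f-injectiveˡ y∈ys x∈xs
    with x′ , _ , x′∈xs′ , _ , fxy≡fx′y′
           ← ∈-cartesianProductWith⁻ f xs′ ys′ (prod⊆ (∈-cartesianProductWith⁺ f x∈xs y∈ys))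
    = subst (_∈ xs′) (sym (f-injectiveˡ fxy≡fx′y′)) x′∈xs′

  cartesianProductWith-cancelʳ : (∀ {x x′ y y′} → f x y ≡ f x′ y′ → y ≡ y′) → ∀ {x} → x ∈ xs → ys ⊆ ys′
  cartesianProductWith-cancelʳ f-injectiveʳ x∈xs y∈ys
    with _ , y′ , _ , y′∈ys′ , fxy≡fx′y′
           ← ∈-cartesianProductWith⁻ f xs′ ys′ (prod⊆ (∈-cartesianProductWith⁺ f x∈xs y∈ys))
    = subst (_∈ ys′) (sym (f-injectiveʳ fxy≡fx′y′)) y′∈ys′

cartesianProductWith-cong : ∀ {A B C : Set} {f g : A → B → C} → (∀ x y → f x y ≡ g x y) →
  ∀ xs ys → cartesianProductWith f xs ys ≡ cartesianProductWith g xs ys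
cartesianProductWith-cong f≗g []       ys = refl
cartesianProductWith-cong f≗g (x ∷ xs) ys =
  cong₂ _++ₗ_ (map-cong (f≗g x) ys) (cartesianProductWith-cong f≗g xs ys)

filterᵇ-cong : ∀ {A : Set} {p q : A → Bool} → (∀ x → p x ≡ q x) → ∀ xs → filterᵇ p xs ≡ filterᵇ q xs
filterᵇ-cong         p≗q []       = refl
filterᵇ-cong {q = q} p≗q (x ∷ xs) rewrite p≗q x with q x
... | true  = cong (x ∷_) (filterᵇ-cong p≗q xs)
... | false = filterᵇ-cong p≗q xs

filterᵇ-map : ∀ {A B : Set} (g : A → B) (p : B → Bool) xs → filterᵇ p (map g xs) ≡ map g (filterᵇ (p ∘ g) xs)
filterᵇ-map g p []       = refl
filterᵇ-map g p (x ∷ xs) with p (g x)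
... | true  = cong (g x ∷_) (filterᵇ-map g p xs)
... | false = filterᵇ-map g p xs

module _ {A B C : Set} (f : A → B → C) {P : C → Bool} {p : A → Bool} {q : B → Bool}
         (P-split : ∀ x y → P (f x y) ≡ p x ∧ q y) where

  any-cartesianProductWith : ∀ xs ys → any P (cartesianProductWith f xs ys) ≡ any p xs ∧ any q ys
  any-cartesianProductWith xs ys = T-injective (mk⇔
    (T-∧ .from ∘ Product.map (Any.any⁺ p) (Any.any⁺ q) ∘ Any.cartesianProductWith⁻ f split xs ys ∘ Any.any⁻ P _)
    (Any.any⁺ P ∘ uncurry (Any.cartesianProductWith⁺ f join) ∘ Product.map (Any.any⁻ p xs) (Any.any⁻ q ys) ∘ T-∧ .to))
    where
    split : ∀ {x y} → T (P (f x y)) → T (p x) × T (q y)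
    split {x} {y} = T-split (P-split x y) .to
    join : ∀ {x y} → T (p x) → T (q y) → T (P (f x y))
    join {x} {y} px qy = T-split (P-split x y) .from (px , qy)

  filterᵇ-cartesianProductWith : ∀ xs ys →
    filterᵇ P (cartesianProductWith f xs ys) ≡ cartesianProductWith f (filterᵇ p xs) (filterᵇ q ys)
  filterᵇ-cartesianProductWith []       ys = refl
  filterᵇ-cartesianProductWith (x ∷ xs) ys = begin
    filterᵇ P (map (f x) ys ++ₗ prod xs ys)
      ≡⟨ filter-++ (T? ∘ P) (map (f x) ys) _ ⟩
    filterᵇ P (map (f x) ys) ++ₗ filterᵇ P (prod xs ys)
      ≡⟨ cong₂ _++ₗ_ row (filterᵇ-cartesianProductWith xs ys) ⟩
    map (f x) (filterᵇ (λ y → p x ∧ q y) ys) ++ₗ prod (filterᵇ p xs) qs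
      ≡⟨ keep-or-drop-row ⟩
    prod (filterᵇ p (x ∷ xs)) qs ∎
    where
    open ≡-Reasoning
    prod = cartesianProductWith f
    qs = filterᵇ q ys
    row : filterᵇ P (map (f x) ys) ≡ map (f x) (filterᵇ (λ y → p x ∧ q y) ys)
    row = trans (filterᵇ-map (f x) P ys) (cong (map (f x)) (filterᵇ-cong (P-split x) ys))
    keep-or-drop-row :
      map (f x) (filterᵇ (λ y → p x ∧ q y) ys) ++ₗ prod (filterᵇ p xs) qs ≡ prod (filterᵇ p (x ∷ xs)) qs
    keep-or-drop-row with p x
    ... | true  = refl
    ... | false = cong (λ r → map (f x) r ++ₗ prod (filterᵇ p xs) qs)
                       (filter-none (T? ∘ const false) (All.universal (λ _ ()) ys))

Unique-map⁺-∈ : ∀ {A B : Set} {g : A → B} {xs} → (∀ {x x′} → x ∈ xs → x′ ∈ xs → g x ≡ g x′ → x ≡ x′) →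
  Unique xs → Unique (map g xs)
Unique-map⁺-∈ {xs = []}     g-inj []           = []
Unique-map⁺-∈ {xs = x ∷ xs} g-inj (x∉xs ∷ xs!) =
  All.map⁺ (All.tabulate λ x′∈xs gx≡gx′ → All.lookup x∉xs x′∈xs (g-inj (here refl) (there x′∈xs) gx≡gx′))
  ∷ Unique-map⁺-∈ (λ x∈ x′∈ → g-inj (there x∈) (there x′∈)) xs!

InjectiveOn : ∀ {A B C : Set} → (A → B → C) → List A → List B → Set
InjectiveOn f xs ys =
  ∀ {x x′ y y′} → x ∈ xs → x′ ∈ xs → y ∈ ys → y′ ∈ ys → f x y ≡ f x′ y′ → x ≡ x′ × y ≡ y′

module _ {A B C : Set} (f : A → B → C) where

  -- Unlike Unique.cartesianProductWith⁺, injectivity is only needed on xs × ys.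
  Unique-cartesianProductWith⁺-∈ : ∀ {xs ys} → InjectiveOn f xs ys →
    Unique xs → Unique ys → Unique (cartesianProductWith f xs ys)
  Unique-cartesianProductWith⁺-∈ {xs} {ys} f-injective xs! ys! =
    subst Unique (map-cartesianProductWith _,_ (uncurry f) xs ys)
          (Unique-map⁺-∈ pair-injective (Unique.cartesianProduct⁺ xs! ys!))
    where
    pair-injective : ∀ {xy xy′} → xy ∈ cartesianProduct xs ys → xy′ ∈ cartesianProduct xs ys →
                     uncurry f xy ≡ uncurry f xy′ → xy ≡ xy′
    pair-injective xy∈ xy′∈ eq with ∈-cartesianProduct⁻ xs ys xy∈ | ∈-cartesianProduct⁻ xs ys xy′∈
    ... | x∈ , y∈ | x′∈ , y′∈ = ×-≡,≡→≡ (f-injective x∈ x′∈ y∈ y′∈ eq)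

  length-deduplicate-cartesianProductWith :
    (_≟ᴬ_ : DecidableEquality A) (_≟ᴮ_ : DecidableEquality B) (_≟ᶜ_ : DecidableEquality C) →
    ∀ {xs ys} → InjectiveOn f xs ys →
    length (deduplicate _≟ᶜ_ (cartesianProductWith f xs ys)) ≡
    length (deduplicate _≟ᴬ_ xs) * length (deduplicate _≟ᴮ_ ys)
  length-deduplicate-cartesianProductWith _≟ᴬ_ _≟ᴮ_ _≟ᶜ_ {xs} {ys} f-injective = begin
    length (deduplicate _≟ᶜ_ (cartesianProductWith f xs ys))
      ≡⟨ ↭-length (∼bag⇒↭ (unique∧set⇒bag (deduplicate-! _≟ᶜ_ _) distinct (mk⇔ ⊆ˡ ⊆ʳ))) ⟩
    length (cartesianProductWith f xs′ ys′)
      ≡⟨ length-cartesianProductWith f xs′ ys′ ⟩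
    length xs′ * length ys′ ∎
    where
    open ≡-Reasoning
    xs′ = deduplicate _≟ᴬ_ xs
    ys′ = deduplicate _≟ᴮ_ ys
    distinct : Unique (cartesianProductWith f xs′ ys′)
    distinct = Unique-cartesianProductWith⁺-∈
      (λ x∈ x′∈ y∈ y′∈ → f-injective (∈-deduplicate⁻ _≟ᴬ_ xs x∈) (∈-deduplicate⁻ _≟ᴬ_ xs x′∈)
                                     (∈-deduplicate⁻ _≟ᴮ_ ys y∈) (∈-deduplicate⁻ _≟ᴮ_ ys y′∈))
      (deduplicate-! _≟ᴬ_ xs) (deduplicate-! _≟ᴮ_ ys)
    ⊆ˡ : deduplicate _≟ᶜ_ (cartesianProductWith f xs ys) ⊆ cartesianProductWith f xs′ ys′
    ⊆ˡ = cartesianProductWith-mono f {xs} {ys = ys} (∈-deduplicate⁺ _≟ᴬ_) (∈-deduplicate⁺ _≟ᴮ_) ∘ ∈-deduplicate⁻ _≟ᶜ_ _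
    ⊆ʳ : cartesianProductWith f xs′ ys′ ⊆ deduplicate _≟ᶜ_ (cartesianProductWith f xs ys)
    ⊆ʳ = ∈-deduplicate⁺ _≟ᶜ_ ∘ cartesianProductWith-mono f (∈-deduplicate⁻ _≟ᴬ_ xs) (∈-deduplicate⁻ _≟ᴮ_ ys)

-- Boolean subsets

allSubsets-+ : ∀ a b → allSubsets (a + b) ≡ cartesianProductWith _++_ (allSubsets a) (allSubsets b)
allSubsets-+ zero    b = sym (trans (++-identityʳ _) (map-id (allSubsets b)))
allSubsets-+ (suc a) b = begin
  map (inside ∷_) (allSubsets (a + b)) ++ₗ map (outside ∷_) (allSubsets (a + b))
    ≡⟨ cong (λ S → map (inside ∷_) S ++ₗ map (outside ∷_) S) (allSubsets-+ a b) ⟩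
  map (inside ∷_) (prod Sa Sb) ++ₗ map (outside ∷_) (prod Sa Sb)
    ≡⟨ cong₂ _++ₗ_ (map-cartesianProductWith _++_ (inside ∷_) Sa Sb)
                   (map-cartesianProductWith _++_ (outside ∷_) Sa Sb) ⟩
  cartesianProductWith (λ u v → inside ∷ u ++ v) Sa Sb ++ₗ cartesianProductWith (λ u v → outside ∷ u ++ v) Sa Sb
    ≡⟨ cong₂ _++ₗ_ (cartesianProductWith-mapˡ _++_ (inside ∷_) Sa Sb)
                   (cartesianProductWith-mapˡ _++_ (outside ∷_) Sa Sb) ⟨
  prod (map (inside ∷_) Sa) Sb ++ₗ prod (map (outside ∷_) Sa) Sb
    ≡⟨ cartesianProductWith-distribʳ-++ _++_ (map (inside ∷_) Sa) (map (outside ∷_) Sa) Sb ⟨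
  prod (allSubsets (suc a)) Sb ∎
  where
  open ≡-Reasoning
  prod : ∀ {m} → List (Subset m) → List (Subset b) → List (Subset (m + b))
  prod = cartesianProductWith _++_
  Sa = allSubsets a
  Sb = allSubsets b

∈-allSubsets : ∀ {n} (X : Subset n) → X ∈ allSubsets n
∈-allSubsets []                    = here refl
∈-allSubsets (inside ∷ X)          = ∈-++⁺ˡ (∈-map⁺ (inside ∷_) (∈-allSubsets X))
∈-allSubsets {suc n} (outside ∷ X) = ∈-++⁺ʳ (map (inside ∷_) (allSubsets n)) (∈-map⁺ (outside ∷_) (∈-allSubsets X))

any-allSubsets⇔ : ∀ {n} {p : Subset n → Bool} → T (any p (allSubsets n)) ⇔ (∃[ X ] T (p X))
any-allSubsets⇔ {n} {p} =
  mk⇔ (satisfied ∘ Any.any⁻ p (allSubsets n)) (λ (X , pX) → Any.any⁺ p (lose (∈-allSubsets X) pX))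

subsetᵇ-refl : ∀ {n} (X : Subset n) → T (subsetᵇ X X)
subsetᵇ-refl []            = _
subsetᵇ-refl (inside  ∷ X) = subsetᵇ-refl X
subsetᵇ-refl (outside ∷ X) = subsetᵇ-refl X

subsetᵇ-antisym : ∀ {n} (X Y : Subset n) → T (subsetᵇ X Y) → T (subsetᵇ Y X) → X ≡ Y
subsetᵇ-antisym []            []            _ _ = refl
subsetᵇ-antisym (inside  ∷ X) (inside  ∷ Y) s t = cong (inside ∷_) (subsetᵇ-antisym X Y s t)
subsetᵇ-antisym (outside ∷ X) (outside ∷ Y) s t = cong (outside ∷_) (subsetᵇ-antisym X Y s t)

∅-subsetᵇ : ∀ {n} (X : Subset n) → T (subsetᵇ ∅ X)
∅-subsetᵇ []      = _
∅-subsetᵇ (_ ∷ X) = ∅-subsetᵇ X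

eqSubᵇ⇔≡ : ∀ {n} {X Y : Subset n} → T (eqSubᵇ X Y) ⇔ X ≡ Y
eqSubᵇ⇔≡ {X = X} {Y} = mk⇔ (uncurry (subsetᵇ-antisym X Y) ∘ T-∧ .to)
                            (λ { refl → T-∧ .from (subsetᵇ-refl X , subsetᵇ-refl X) })

subsetᵇ⇒∣∣≤ : ∀ {n} (X Y : Subset n) → T (subsetᵇ X Y) → ∣ X ∣ ≤ ∣ Y ∣
subsetᵇ⇒∣∣≤ []            []            _ = z≤n
subsetᵇ⇒∣∣≤ (inside  ∷ X) (inside  ∷ Y) s = s≤s (subsetᵇ⇒∣∣≤ X Y s)
subsetᵇ⇒∣∣≤ (outside ∷ X) (inside  ∷ Y) s = m≤n⇒m≤1+n (subsetᵇ⇒∣∣≤ X Y s)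
subsetᵇ⇒∣∣≤ (outside ∷ X) (outside ∷ Y) s = subsetᵇ⇒∣∣≤ X Y s

subsetᵇ∧≢⇒∣∣< : ∀ {n} (X Y : Subset n) → T (subsetᵇ X Y) → X ≢ Y → ∣ X ∣ < ∣ Y ∣
subsetᵇ∧≢⇒∣∣< []            []            _ X≢Y = ⊥-elim (X≢Y refl)
subsetᵇ∧≢⇒∣∣< (inside  ∷ X) (inside  ∷ Y) s X≢Y = s≤s (subsetᵇ∧≢⇒∣∣< X Y s (X≢Y ∘ cong (inside ∷_)))
subsetᵇ∧≢⇒∣∣< (outside ∷ X) (inside  ∷ Y) s _   = s≤s (subsetᵇ⇒∣∣≤ X Y s)
subsetᵇ∧≢⇒∣∣< (outside ∷ X) (outside ∷ Y) s X≢Y = subsetᵇ∧≢⇒∣∣< X Y s (X≢Y ∘ cong (outside ∷_))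

∅-disjointᵇ : ∀ {n} (X : Subset n) → T (disjointᵇ ∅ X)
∅-disjointᵇ []      = _
∅-disjointᵇ (_ ∷ X) = ∅-disjointᵇ X

∅-++ : ∀ a {b} → ∅ {a + b} ≡ ∅ {a} ++ ∅ {b}
∅-++ zero    = refl
∅-++ (suc a) = cong (outside ∷_) (∅-++ a)

take-++ : ∀ {A : Set} a {b} (u : Vec A a) (v : Vec A b) → take a (u ++ v) ≡ u
take-++ zero    []      v = refl
take-++ (suc a) (x ∷ u) v = cong (x ∷_) (take-++ a u v)

drop-++ : ∀ {A : Set} a {b} (u : Vec A a) (v : Vec A b) → drop a (u ++ v) ≡ v
drop-++ zero    []      v = refl
drop-++ (suc a) (x ∷ u) v = drop-++ a u v

subsetᵇ-++ : ∀ {a b} (u u′ : Subset a) (v v′ : Subset b) →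
  subsetᵇ (u ++ v) (u′ ++ v′) ≡ subsetᵇ u u′ ∧ subsetᵇ v v′
subsetᵇ-++ []      []        v v′ = refl
subsetᵇ-++ (x ∷ u) (x′ ∷ u′) v v′ =
  trans (cong ((not x ∨ x′) ∧_) (subsetᵇ-++ u u′ v v′)) (sym (∧-assoc (not x ∨ x′) _ _))

eqSubᵇ-++ : ∀ {a b} (u u′ : Subset a) (v v′ : Subset b) →
  eqSubᵇ (u ++ v) (u′ ++ v′) ≡ eqSubᵇ u u′ ∧ eqSubᵇ v v′
eqSubᵇ-++ u u′ v v′ =
  trans (cong₂ _∧_ (subsetᵇ-++ u u′ v v′) (subsetᵇ-++ u′ u v′ v))
        (∧-interchange (subsetᵇ u u′) (subsetᵇ v v′) (subsetᵇ u′ u) (subsetᵇ v′ v))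

disjointᵇ-++ : ∀ {a b} (u u′ : Subset a) (v v′ : Subset b) →
  disjointᵇ (u ++ v) (u′ ++ v′) ≡ disjointᵇ u u′ ∧ disjointᵇ v v′
disjointᵇ-++ {a} u u′ v v′ =
  trans (cong₂ eqSubᵇ (zipWith-++ _∧_ u v u′ v′) (∅-++ a)) (eqSubᵇ-++ (u ∩ₛ u′) ∅ (v ∩ₛ v′) ∅)

-- Bases and minors

-- isBasisOfᵇ ind C J unfolds to  subsetᵇ J C ∧ ind J ∧ not (any (properExtensionᵇ ind C J) (allSubsets n)).
properExtensionᵇ : ∀ {n} → Oracle n → (C J K : Subset n) → Bool
properExtensionᵇ ind C J K = subsetᵇ J K ∧ subsetᵇ K C ∧ not (eqSubᵇ J K) ∧ ind K

ProperExtension : ∀ {n} → Oracle n → (C J K : Subset n) → Set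
ProperExtension ind C J K = T (subsetᵇ J K) × T (subsetᵇ K C) × J ≢ K × T (ind K)

properExtensionᵇ⇔ : ∀ {n} {ind : Oracle n} {C J K} → T (properExtensionᵇ ind C J K) ⇔ ProperExtension ind C J K
properExtensionᵇ⇔ = mk⇔
  (λ t → let J⊆K , t₁ = T-∧ .to t
             K⊆C , t₂ = T-∧ .to t₁
             J≠ᵇK , K-indep = T-∧ .to t₂
         in J⊆K , K⊆C , T-not .to J≠ᵇK ∘ eqSubᵇ⇔≡ .from , K-indep)
  (λ (J⊆K , K⊆C , J≢K , K-indep) →
     T-∧ .from (J⊆K , T-∧ .from (K⊆C , T-∧ .from (T-not .from (J≢K ∘ eqSubᵇ⇔≡ .to) , K-indep))))

isBasisOfᵇ⇔ : ∀ {n} {ind : Oracle n} {C J} →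
  T (isBasisOfᵇ ind C J) ⇔ (T (subsetᵇ J C) × T (ind J) × ∀ K → ¬ ProperExtension ind C J K)
isBasisOfᵇ⇔ {ind = ind} {C} {J} = mk⇔
  (λ t → let J⊆C , t₁ = T-∧ .to t
             J-indep , t₂ = T-∧ .to t₁
         in J⊆C , J-indep , λ K e → T-not .to t₂ (extensible .from (K , properExtensionᵇ⇔ {ind = ind} .from e)))
  (λ (J⊆C , J-indep , maximal) →
     T-∧ .from (J⊆C , T-∧ .from (J-indep , T-not .from λ t →
       let K , e = extensible .to t in maximal K (properExtensionᵇ⇔ {ind = ind} .to e))))
  where
  extensible = any-allSubsets⇔ {p = properExtensionᵇ ind C J}

largestIndepSubset : ∀ {n} → Oracle n → Subset n → Subset n
largestIndepSubset {n} ind C = argmax ∣_∣ ∅ (filterᵇ (λ K → subsetᵇ K C ∧ ind K) (allSubsets n))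

largestIndepSubset-isBasis : ∀ {n} {ind : Oracle n} → T (ind ∅) → ∀ C →
  T (isBasisOfᵇ ind C (largestIndepSubset ind C))
largestIndepSubset-isBasis {n} {ind} ind-∅ C =
  let J⊆C , J-indep = T-∧ .to J-candidate in isBasisOfᵇ⇔ .from (J⊆C , J-indep , maximal)
  where
  candidate = λ K → subsetᵇ K C ∧ ind K
  candidates = filterᵇ candidate (allSubsets n)
  J = largestIndepSubset ind C
  J-candidate : T (subsetᵇ J C ∧ ind J)
  J-candidate = argmax-all ∣_∣ {P = T ∘ candidate} (T-∧ .from (∅-subsetᵇ C , ind-∅))
                           (All.all-filter (T? ∘ candidate) (allSubsets n))
  maximal : ∀ K → ¬ ProperExtension ind C J K
  maximal K (J⊆K , K⊆C , J≢K , K-indep) = <⇒≱ (subsetᵇ∧≢⇒∣∣< J K J⊆K J≢K)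
    (All.lookup (f[xs]≤f[argmax] ∅ candidates)
                (∈-filter⁺ (T? ∘ candidate) (∈-allSubsets K) (T-∧ .from (K⊆C , K-indep))))

∅-minorIndep : ∀ {n} {ind : Oracle n} → T (ind ∅) → ∀ D C → T (minorIndep ind D C ∅)
∅-minorIndep {ind = ind} ind-∅ D C =
  T-∧ .from (∅-disjointᵇ (D ∪ₛ C) , any-allSubsets⇔ .from (B , T-∧ .from (B-basis , ∅∪B-indep)))
  where
  B = largestIndepSubset ind C
  B-basis = largestIndepSubset-isBasis ind-∅ C
  ∅∪B-indep : T (ind (∅ ∪ₛ B))
  ∅∪B-indep = subst (T ∘ ind) (sym (∪-identityˡ B)) (proj₁ (proj₂ (isBasisOfᵇ⇔ {ind = ind} {C} {B} .to B-basis)))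

∈-indepSets⁺ : ∀ {n} (ind : Oracle n) {I} → T (ind I) → I ∈ indepSets ind
∈-indepSets⁺ ind {I} = ∈-filter⁺ (T? ∘ ind) (∈-allSubsets I)

∈-indepSets⁻ : ∀ {n} (ind : Oracle n) {I} → I ∈ indepSets ind → T (ind I)
∈-indepSets⁻ {n} ind = proj₂ ∘ ∈-filter⁻ (T? ∘ ind) {xs = allSubsets n}

indepSets-≡ : ∀ {n} (ind ind′ : Oracle n) → indepSets ind ⊆ indepSets ind′ → indepSets ind′ ⊆ indepSets ind →
  indepSets ind ≡ indepSets ind′
indepSets-≡ {n} ind ind′ ⊆′ ⊇′ = filter-≐ (T? ∘ ind) (T? ∘ ind′)
  (∈-indepSets⁻ ind′ ∘ ⊆′ ∘ ∈-indepSets⁺ ind , ∈-indepSets⁻ ind ∘ ⊇′ ∘ ∈-indepSets⁺ ind′) (allSubsets n)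

-- Direct sums

IsDirectSum : ∀ {a b} → Oracle (a + b) → Oracle a → Oracle b → Set
IsDirectSum {a} {b} P p q = ∀ (u : Subset a) (v : Subset b) → P (u ++ v) ≡ p u ∧ q v

directSum-isDirectSum : ∀ {a b} (M₁ : Matroid a) (M₂ : Matroid b) →
  IsDirectSum (directSum M₁ M₂) (indep M₁) (indep M₂)
directSum-isDirectSum {a} M₁ M₂ u v =
  cong₂ (λ u′ v′ → indep M₁ u′ ∧ indep M₂ v′) (take-++ a u v) (drop-++ a u v)

indepSets-isDirectSum : ∀ {a b} {P : Oracle (a + b)} {p : Oracle a} {q : Oracle b} → IsDirectSum P p q →
  indepSets P ≡ cartesianProductWith _++_ (indepSets p) (indepSets q)
indepSets-isDirectSum {a} {b} {P} P-split =
  trans (cong (filterᵇ P) (allSubsets-+ a b)) (filterᵇ-cartesianProductWith _++_ P-split (allSubsets a) (allSubsets b))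

module _ {a b} {P : Oracle (a + b)} {p : Oracle a} {q : Oracle b} (P-split : IsDirectSum P p q) where

  properExtension-split : ∀ {C₁ J₁ K₁ C₂ J₂ K₂} → ProperExtension P (C₁ ++ C₂) (J₁ ++ J₂) (K₁ ++ K₂) →
    ProperExtension p C₁ J₁ K₁ ⊎ ProperExtension q C₂ J₂ K₂
  properExtension-split {C₁} {J₁} {K₁} {C₂} {J₂} {K₂} (J⊆K , K⊆C , J≢K , K-indep)
    with J₁⊆K₁ , J₂⊆K₂ ← T-split (subsetᵇ-++ J₁ K₁ J₂ K₂) .to J⊆K
       | K₁⊆C₁ , K₂⊆C₂ ← T-split (subsetᵇ-++ K₁ C₁ K₂ C₂) .to K⊆C
       | K₁-indep , K₂-indep ← T-split (P-split K₁ K₂) .to K-indep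
       | J₁ ≟ₛ K₁
  ... | no J₁≢K₁ = inj₁ (J₁⊆K₁ , K₁⊆C₁ , J₁≢K₁ , K₁-indep)
  ... | yes refl = inj₂ (J₂⊆K₂ , K₂⊆C₂ , J≢K ∘ cong (J₁ ++_) , K₂-indep)

  properExtension-inj₁ : ∀ {C₁ J₁ K₁ C₂ J₂} → T (subsetᵇ J₂ C₂) → T (q J₂) →
    ProperExtension p C₁ J₁ K₁ → ProperExtension P (C₁ ++ C₂) (J₁ ++ J₂) (K₁ ++ J₂)
  properExtension-inj₁ {C₁} {J₁} {K₁} {C₂} {J₂} J₂⊆C₂ J₂-indep (J₁⊆K₁ , K₁⊆C₁ , J₁≢K₁ , K₁-indep) =
    T-split (subsetᵇ-++ J₁ K₁ J₂ J₂) .from (J₁⊆K₁ , subsetᵇ-refl J₂) ,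
    T-split (subsetᵇ-++ K₁ C₁ J₂ C₂) .from (K₁⊆C₁ , J₂⊆C₂) ,
    J₁≢K₁ ∘ ++-injectiveˡ J₁ K₁ ,
    T-split (P-split K₁ J₂) .from (K₁-indep , J₂-indep)

  properExtension-inj₂ : ∀ {C₁ J₁ C₂ J₂ K₂} → T (subsetᵇ J₁ C₁) → T (p J₁) →
    ProperExtension q C₂ J₂ K₂ → ProperExtension P (C₁ ++ C₂) (J₁ ++ J₂) (J₁ ++ K₂)
  properExtension-inj₂ {C₁} {J₁} {C₂} {J₂} {K₂} J₁⊆C₁ J₁-indep (J₂⊆K₂ , K₂⊆C₂ , J₂≢K₂ , K₂-indep) =
    T-split (subsetᵇ-++ J₁ J₁ J₂ K₂) .from (subsetᵇ-refl J₁ , J₂⊆K₂) ,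
    T-split (subsetᵇ-++ J₁ C₁ K₂ C₂) .from (J₁⊆C₁ , K₂⊆C₂) ,
    J₂≢K₂ ∘ ++-injectiveʳ J₁ J₁ ,
    T-split (P-split J₁ K₂) .from (J₁-indep , K₂-indep)

  maximal-++ : ∀ {C₁ J₁ C₂ J₂} → (∀ K₁ → ¬ ProperExtension p C₁ J₁ K₁) → (∀ K₂ → ¬ ProperExtension q C₂ J₂ K₂) →
    ∀ K → ¬ ProperExtension P (C₁ ++ C₂) (J₁ ++ J₂) K
  maximal-++ maximal₁ maximal₂ K with K₁ , K₂ , refl ← splitAt a K =
    [ maximal₁ K₁ , maximal₂ K₂ ]′ ∘ properExtension-split

  isBasisOfᵇ-++ : ∀ C₁ C₂ J₁ J₂ → isBasisOfᵇ P (C₁ ++ C₂) (J₁ ++ J₂) ≡ isBasisOfᵇ p C₁ J₁ ∧ isBasisOfᵇ q C₂ J₂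
  isBasisOfᵇ-++ C₁ C₂ J₁ J₂ = T-injective (mk⇔ restrict combine)
    where
    J⊆C⇔ = T-split (subsetᵇ-++ J₁ C₁ J₂ C₂)
    J-indep⇔ = T-split (P-split J₁ J₂)
    restrict : T (isBasisOfᵇ P (C₁ ++ C₂) (J₁ ++ J₂)) → T (isBasisOfᵇ p C₁ J₁ ∧ isBasisOfᵇ q C₂ J₂)
    restrict t =
      let J⊆C , J-indep , maximal = isBasisOfᵇ⇔ .to t
          J₁⊆C₁ , J₂⊆C₂ = J⊆C⇔ .to J⊆C
          J₁-indep , J₂-indep = J-indep⇔ .to J-indep
      in T-∧ .from
        ( isBasisOfᵇ⇔ .from (J₁⊆C₁ , J₁-indep , λ K₁ → maximal (K₁ ++ J₂) ∘ properExtension-inj₁ J₂⊆C₂ J₂-indep)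
        , isBasisOfᵇ⇔ .from (J₂⊆C₂ , J₂-indep , λ K₂ → maximal (J₁ ++ K₂) ∘ properExtension-inj₂ J₁⊆C₁ J₁-indep))
    combine : T (isBasisOfᵇ p C₁ J₁ ∧ isBasisOfᵇ q C₂ J₂) → T (isBasisOfᵇ P (C₁ ++ C₂) (J₁ ++ J₂))
    combine t =
      let t₁ , t₂ = T-∧ .to t
          J₁⊆C₁ , J₁-indep , maximal₁ = isBasisOfᵇ⇔ .to t₁
          J₂⊆C₂ , J₂-indep , maximal₂ = isBasisOfᵇ⇔ .to t₂
      in isBasisOfᵇ⇔ .from ( J⊆C⇔ .from (J₁⊆C₁ , J₂⊆C₂) , J-indep⇔ .from (J₁-indep , J₂-indep)
                           , maximal-++ maximal₁ maximal₂)

  minorIndep-isDirectSum : ∀ D₁ D₂ C₁ C₂ →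
    IsDirectSum (minorIndep P (D₁ ++ D₂) (C₁ ++ C₂)) (minorIndep p D₁ C₁) (minorIndep q D₂ C₂)
  minorIndep-isDirectSum D₁ D₂ C₁ C₂ u v = begin
    disjointᵇ (u ++ v) ((D₁ ++ D₂) ∪ₛ (C₁ ++ C₂)) ∧ any F (allSubsets (a + b))
      ≡⟨ cong₂ _∧_ disjoint-split basis-split ⟩
    (disjointᵇ u (D₁ ∪ₛ C₁) ∧ disjointᵇ v (D₂ ∪ₛ C₂)) ∧ (any F₁ (allSubsets a) ∧ any F₂ (allSubsets b))
      ≡⟨ ∧-interchange (disjointᵇ u (D₁ ∪ₛ C₁)) _ _ _ ⟩
    minorIndep p D₁ C₁ u ∧ minorIndep q D₂ C₂ v ∎
    where
    open ≡-Reasoning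
    F = λ J → isBasisOfᵇ P (C₁ ++ C₂) J ∧ P ((u ++ v) ∪ₛ J)
    F₁ = λ J₁ → isBasisOfᵇ p C₁ J₁ ∧ p (u ∪ₛ J₁)
    F₂ = λ J₂ → isBasisOfᵇ q C₂ J₂ ∧ q (v ∪ₛ J₂)
    disjoint-split = trans (cong (disjointᵇ (u ++ v)) (zipWith-++ _∨_ D₁ D₂ C₁ C₂))
                           (disjointᵇ-++ u (D₁ ∪ₛ C₁) v (D₂ ∪ₛ C₂))
    F-split : ∀ J₁ J₂ → F (J₁ ++ J₂) ≡ F₁ J₁ ∧ F₂ J₂
    F-split J₁ J₂ = trans
      (cong₂ _∧_ (isBasisOfᵇ-++ C₁ C₂ J₁ J₂) (trans (cong P (zipWith-++ _∨_ u v J₁ J₂)) (P-split (u ∪ₛ J₁) (v ∪ₛ J₂))))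
      (∧-interchange (isBasisOfᵇ p C₁ J₁) _ _ _)
    basis-split = trans (cong (any F) (allSubsets-+ a b))
                        (any-cartesianProductWith _++_ F-split (allSubsets a) (allSubsets b))

  minorsOn-isDirectSum : ∀ X₁ X₂ →
    minorsOn P (X₁ ++ X₂) ≡ cartesianProductWith (cartesianProductWith _++_) (minorsOn p X₁) (minorsOn q X₂)
  minorsOn-isDirectSum X₁ X₂ = begin
    map G (filterᵇ (λ Y → subsetᵇ Y (X₁ ++ X₂)) (allSubsets (a + b)))
      ≡⟨ cong (map G) (trans (cong (filterᵇ _) (allSubsets-+ a b))
                             (filterᵇ-cartesianProductWith _++_ Y-split (allSubsets a) (allSubsets b))) ⟩
    map G (cartesianProductWith _++_ 𝒴₁ 𝒴₂)
      ≡⟨ map-cartesianProductWith _++_ G 𝒴₁ 𝒴₂ ⟩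
    cartesianProductWith (λ Y₁ Y₂ → G (Y₁ ++ Y₂)) 𝒴₁ 𝒴₂
      ≡⟨ cartesianProductWith-cong G-split 𝒴₁ 𝒴₂ ⟩
    cartesianProductWith (λ Y₁ Y₂ → cartesianProductWith _++_ (G₁ Y₁) (G₂ Y₂)) 𝒴₁ 𝒴₂
      ≡⟨ cartesianProductWith-mapʳ _ G₂ 𝒴₁ 𝒴₂ ⟨
    cartesianProductWith (λ Y₁ → cartesianProductWith _++_ (G₁ Y₁)) 𝒴₁ (map G₂ 𝒴₂)
      ≡⟨ cartesianProductWith-mapˡ _ G₁ 𝒴₁ (map G₂ 𝒴₂) ⟨
    cartesianProductWith (cartesianProductWith _++_) (map G₁ 𝒴₁) (map G₂ 𝒴₂) ∎
    where
    open ≡-Reasoning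
    G = λ Y → indepSets (minorIndep P ((X₁ ++ X₂) ∖ Y) Y)
    G₁ = λ Y₁ → indepSets (minorIndep p (X₁ ∖ Y₁) Y₁)
    G₂ = λ Y₂ → indepSets (minorIndep q (X₂ ∖ Y₂) Y₂)
    𝒴₁ = filterᵇ (λ Y₁ → subsetᵇ Y₁ X₁) (allSubsets a)
    𝒴₂ = filterᵇ (λ Y₂ → subsetᵇ Y₂ X₂) (allSubsets b)
    Y-split : ∀ Y₁ Y₂ → subsetᵇ (Y₁ ++ Y₂) (X₁ ++ X₂) ≡ subsetᵇ Y₁ X₁ ∧ subsetᵇ Y₂ X₂
    Y-split Y₁ Y₂ = subsetᵇ-++ Y₁ X₁ Y₂ X₂
    G-split : ∀ Y₁ Y₂ → G (Y₁ ++ Y₂) ≡ cartesianProductWith _++_ (G₁ Y₁) (G₂ Y₂)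
    G-split Y₁ Y₂ = trans (cong (λ D → indepSets (minorIndep P D (Y₁ ++ Y₂))) (zipWith-++ _ X₁ X₂ Y₁ Y₂))
                          (indepSets-isDirectSum (minorIndep-isDirectSum (X₁ ∖ Y₁) (X₂ ∖ Y₂) Y₁ Y₂))

indepSets-cartesianProduct-injective : ∀ {a b} (r₁ r₁′ : Oracle a) (r₂ r₂′ : Oracle b) →
  T (r₁ ∅) → T (r₁′ ∅) → T (r₂ ∅) → T (r₂′ ∅) →
  cartesianProductWith _++_ (indepSets r₁) (indepSets r₂) ≡ cartesianProductWith _++_ (indepSets r₁′) (indepSets r₂′) →
  indepSets r₁ ≡ indepSets r₁′ × indepSets r₂ ≡ indepSets r₂′
indepSets-cartesianProduct-injective r₁ r₁′ r₂ r₂′ r₁-∅ r₁′-∅ r₂-∅ r₂′-∅ eq =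
  indepSets-≡ r₁ r₁′
    (cartesianProductWith-cancelˡ {ys′ = indepSets r₂′} (⊆-reflexive eq) (++-injectiveˡ _ _) (∈-indepSets⁺ r₂ r₂-∅))
    (cartesianProductWith-cancelˡ {ys′ = indepSets r₂} (⊆-reflexive (sym eq)) (++-injectiveˡ _ _) (∈-indepSets⁺ r₂′ r₂′-∅)) ,
  indepSets-≡ r₂ r₂′
    (cartesianProductWith-cancelʳ {xs′ = indepSets r₁′} (⊆-reflexive eq) (++-injectiveʳ _ _) (∈-indepSets⁺ r₁ r₁-∅))
    (cartesianProductWith-cancelʳ {xs′ = indepSets r₁} (⊆-reflexive (sym eq)) (++-injectiveʳ _ _) (∈-indepSets⁺ r₁′ r₁′-∅))

minorsOn-injective : ∀ {a b} {r₁ : Oracle a} {r₂ : Oracle b} → T (r₁ ∅) → T (r₂ ∅) →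
  ∀ X₁ X₂ → InjectiveOn (cartesianProductWith _++_) (minorsOn r₁ X₁) (minorsOn r₂ X₂)
minorsOn-injective {r₁ = r₁} {r₂} r₁-∅ r₂-∅ X₁ X₂ m₁∈ m₁′∈ m₂∈ m₂′∈
  with Y₁ , _ , refl ← ∈-map⁻ _ m₁∈ | Y₁′ , _ , refl ← ∈-map⁻ _ m₁′∈
     | Y₂ , _ , refl ← ∈-map⁻ _ m₂∈ | Y₂′ , _ , refl ← ∈-map⁻ _ m₂′∈ =
  indepSets-cartesianProduct-injective (minor₁ Y₁) (minor₁ Y₁′) (minor₂ Y₂) (minor₂ Y₂′)
    (minor₁-∅ Y₁) (minor₁-∅ Y₁′) (minor₂-∅ Y₂) (minor₂-∅ Y₂′)
  where
  minor₁ = λ Y → minorIndep r₁ (X₁ ∖ Y) Y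
  minor₂ = λ Y → minorIndep r₂ (X₂ ∖ Y) Y
  minor₁-∅ = λ Y → ∅-minorIndep r₁-∅ (X₁ ∖ Y) Y
  minor₂-∅ = λ Y → ∅-minorIndep r₂-∅ (X₂ ∖ Y) Y

lemma4p4 : ∀ {a b} (M₁ : Matroid a) (M₂ : Matroid b) (X₁ : Subset a) (X₂ : Subset b) →
    numMinorsOn (directSum M₁ M₂) (X₁ ++ X₂) ≡ numMinorsOn (indep M₁) X₁ * numMinorsOn (indep M₂) X₂
lemma4p4 M₁ M₂ X₁ X₂ = begin
  numMinorsOn (directSum M₁ M₂) (X₁ ++ X₂)
    ≡⟨ cong (length ∘ deduplicate _≟ₗ_) (minorsOn-isDirectSum (directSum-isDirectSum M₁ M₂) X₁ X₂) ⟩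
  length (deduplicate _≟ₗ_ (cartesianProductWith (cartesianProductWith _++_) 𝓜₁ 𝓜₂))
    ≡⟨ length-deduplicate-cartesianProductWith _ _≟ₗ_ _≟ₗ_ _≟ₗ_ (minorsOn-injective (indep-∅ M₁) (indep-∅ M₂) X₁ X₂) ⟩
  numMinorsOn (indep M₁) X₁ * numMinorsOn (indep M₂) X₂ ∎
  where
  open ≡-Reasoning
  𝓜₁ = minorsOn (indep M₁) X₁
  𝓜₂ = minorsOn (indep M₂) X₂
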